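{- Let $L\subseteq\mathcal{L}$ be a finite signature and $i\in\mathbb{I}(L)$. Then $\sigma_{o|L}(i)\subseteq\sigma_{|L}(i)$.
   Context: Fix a universe $\mathcal{L}$ of lifelines and a universe $\mathcal{M}$ of messages. For $l\in\mathcal{L}$, $\mathbb{A}_l=\{l!m,\ l?m\mid m\in\mathcal{M}\}$ with $\theta(a)=l$ for $a\in\mathbb{A}_l$, and $\mathbb{T}_l=\mathbb{A}_l^*$. Multi-traces: for finite $L$, $\mathbb{A}(L)=\bigcup_{l\in L}\mathbb{A}_l$ and $\mathbb{M}(L)=\prod_{l\in L}\mathbb{T}_l$, with empty multi-trace $\varepsilon_L$. The multi-trace $a\,\hat{}\,\mu$ is $\mu$ with its $\theta(a)$-component $t$ replaced by $a.t$. Operations on multi-traces: - $\mu_1\cup\mu_2=\{\mu_1,\mu_2\}$. - $\mu_1;\mu_2$ is the componentwise concatenation. - $\mu_1\,||\,\mu_2$ is the set of componentwise shuffles of $\mu_1$ and $\mu_2$. These are extended to sets via unions over pairs. For $\diamond\in\{;,||\}$, $T^{\diamond*}=\bigcup_{j\ge0}T^{\diamond j}$, with $T^{\diamond0}=\{\varepsilon_L\}$ and $T^{\diamond j}=T\diamond T^{\diamond(j-1)}$. Interactions: $\mathbb{I}(L)$ is the set of ground terms built from $\varnothing$, actions $a\in\mathbb{A}(L)$, the unary operators $loop_S,loop_P$ and the binary operators $seq,par,alt$. Denotational semantics $\sigma_{|L}$: - $\sigma_{|L}(\varnothing)=\{\varepsilon_L\}$ and $\sigma_{|L}(a)=\{a\,\hat{}\,\varepsilon_L\}$;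 - $seq$, $par$, $alt$ are interpreted by $;$, $||$, $\cup$; - $loop_S$, $loop_P$ are interpreted by ${}^{;*}$, ${}^{||*}$. Termination predicate $\downarrow$: it is the smallest predicate such that - $\varnothing\downarrow$; - $loop_k(i_1)\downarrow$; - $alt(i_1,i_2)\downarrow$ if $i_1\downarrow$ or $i_2\downarrow$; - $seq(i_1,i_2)\downarrow$ and $par(i_1,i_2)\downarrow$ if both $i_1\downarrow$ and $i_2\downarrow$. Execution relation $\rightarrow$: it is the smallest relation such that - $a\xrightarrow{a}\varnothing$; - if $i_1\xrightarrow{a}i_1'$, then $alt(i_1,i_2)\xrightarrow{a}i_1'$, $par(i_1,i_2)\xrightarrow{a}par(i_1',i_2)$, $seq(i_1,i_2)\xrightarrow{a}seq(i_1',i_2)$, $loop_S(i_1)\xrightarrow{a}seq(i_1',loop_S(i_1))$ and $loop_P(i_1)\xrightarrow{a}par(i_1',loop_P(i_1))$; - if $i_2\xrightarrow{a}i_2'$, then $alt(i_1,i_2)\xrightarrow{a}i_2'$ and $par(i_1,i_2)\xrightarrow{a}par(i_1,i_2')$; - if $i_2\xrightarrow{a}i_2'$ and $i_1\downarrow$, then $seq(i_1,i_2)\xrightarrow{a}i_2'$. Operational semantics $\sigma_{o|L}:\mathbb{I}(L)\to\mathcal{P}(\mathbb{M}(L))$: it is the least family of sets such that - if $i\downarrow$ then $\varepsilon_L\in\sigma_{o|L}(i)$; - if $\mu\in\sigma_{o|L}(i')$ and $i\xrightarrow{a}i'$, then $a\,\hat{}\,\mu\in\sigma_{o|L}(i)$.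 -}

module Defs where

open import Data.List using (List; []; _∷_; _++_)
open import Data.List.Membership.Propositional using (_∈_)
open import Data.List.Relation.Unary.Any using (here; there)
open import Data.List.Relation.Unary.All using (All; []; _∷_)
open import Data.Nat using (ℕ; zero; suc)
open import Data.Product using (Σ; ∃; _×_; _,_)
open import Relation.Binary.PropositionalEquality using (_≡_; refl)

-- Lifeline universe 𝓛 and message universe 𝓜 are arbitrary types.
-- A finite signature L ⊆ 𝓛 is given as a (duplicate-free) list.

data Kind : Set where
  emit    : Kind
  receive : Kind

module _ {Lf M : Set} where

  -- an action of A_l (its lifeline θ(a) = l is the index)
  record ActOn (l : Lf) : Set where
    constructor act
    field
      kind : Kind
      msg  : M

  Trace : Lf → Set
  Trace l = List (ActOn l)

  -- A(L) = ⋃_{l∈L} A_l : an action records its lifeline θ(a) and that θ(a) ∈ L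
  record Action (L : List Lf) : Set where
    constructor mkAction
    field
      θ    : Lf
      θ∈L  : θ ∈ L
      base : ActOn θ

  MTrace : List Lf → Set
  MTrace L = All Trace L

  ε : (L : List Lf) → MTrace L
  ε []      = []
  ε (_ ∷ L) = [] ∷ ε L

  prependAt : ∀ {L l} → l ∈ L → ActOn l → MTrace L → MTrace L
  prependAt (here refl) x (t ∷ μ) = (x ∷ t) ∷ μ
  prependAt (there p)   x (t ∷ μ) = t ∷ prependAt p x μ

  _^_ : ∀ {L} → Action L → MTrace L → MTrace L
  mkAction l p x ^ μ = prependAt p x μ

  _⨟_ : ∀ {L} → MTrace L → MTrace L → MTrace L
  [] ⨟ [] = []
  (t₁ ∷ μ₁) ⨟ (t₂ ∷ μ₂) = (t₁ ++ t₂) ∷ (μ₁ ⨟ μ₂)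

  data Shuffle {A : Set} : List A → List A → List A → Set where
    sh[] : Shuffle [] [] []
    shˡ  : ∀ {x xs ys zs} → Shuffle xs ys zs → Shuffle (x ∷ xs) ys (x ∷ zs)
    shʳ  : ∀ {y xs ys zs} → Shuffle xs ys zs → Shuffle xs (y ∷ ys) (y ∷ zs)

  MShuffle : ∀ {L} → MTrace L → MTrace L → MTrace L → Set
  MShuffle [] [] [] = Data.Unit.⊤ where import Data.Unit
  MShuffle (t₁ ∷ μ₁) (t₂ ∷ μ₂) (t ∷ μ) = Shuffle t₁ t₂ t × MShuffle μ₁ μ₂ μ

  MSet : List Lf → Set₁
  MSet L = MTrace L → Set

  _∪ₛ_ : ∀ {L} → MSet L → MSet L → MSet L
  (T₁ ∪ₛ T₂) μ = Data.Sum._⊎_ (T₁ μ) (T₂ μ) where import Data.Sum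

  _⨟ₛ_ : ∀ {L} → MSet L → MSet L → MSet L
  (T₁ ⨟ₛ T₂) μ = Σ _ λ μ₁ → Σ _ λ μ₂ → T₁ μ₁ × T₂ μ₂ × μ ≡ (μ₁ ⨟ μ₂)

  _∥ₛ_ : ∀ {L} → MSet L → MSet L → MSet L
  (T₁ ∥ₛ T₂) μ = Σ _ λ μ₁ → Σ _ λ μ₂ → T₁ μ₁ × T₂ μ₂ × MShuffle μ₁ μ₂ μ

  power : ∀ {L} → (MSet L → MSet L → MSet L) → MSet L → ℕ → MSet L
  power {L} _◇_ T zero    μ = μ ≡ ε L
  power     _◇_ T (suc j) = T ◇ power _◇_ T j

  star : ∀ {L} → (MSet L → MSet L → MSet L) → MSet L → MSet L
  star _◇_ T μ = ∃ λ j → power _◇_ T j μ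

  data Interaction (L : List Lf) : Set where
    ∅     : Interaction L
    ac    : Action L → Interaction L
    loopS : Interaction L → Interaction L
    loopP : Interaction L → Interaction L
    seq   : Interaction L → Interaction L → Interaction L
    par   : Interaction L → Interaction L → Interaction L
    alt   : Interaction L → Interaction L → Interaction L

  σ : ∀ {L} → Interaction L → MSet L
  σ {L} ∅ μ      = μ ≡ ε L
  σ {L} (ac a) μ = μ ≡ (a ^ ε L)
  σ (loopS i)    = star _⨟ₛ_ (σ i)
  σ (loopP i)    = star _∥ₛ_ (σ i)
  σ (seq i₁ i₂)  = σ i₁ ⨟ₛ σ i₂
  σ (par i₁ i₂)  = σ i₁ ∥ₛ σ i₂
  σ (alt i₁ i₂)  = σ i₁ ∪ₛ σ i₂

  data _↓ {L} : Interaction L → Set where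
    ∅↓    : ∅ ↓
    loopS↓ : ∀ {i} → loopS i ↓
    loopP↓ : ∀ {i} → loopP i ↓
    altˡ↓ : ∀ {i₁ i₂} → i₁ ↓ → alt i₁ i₂ ↓
    altʳ↓ : ∀ {i₁ i₂} → i₂ ↓ → alt i₁ i₂ ↓
    seq↓  : ∀ {i₁ i₂} → i₁ ↓ → i₂ ↓ → seq i₁ i₂ ↓
    par↓  : ∀ {i₁ i₂} → i₁ ↓ → i₂ ↓ → par i₁ i₂ ↓

  data _─_⟶_ {L} : Interaction L → Action L → Interaction L → Set where
    act-ex  : ∀ {a} → ac a ─ a ⟶ ∅
    altˡ    : ∀ {a i₁ i₁' i₂} → i₁ ─ a ⟶ i₁' → alt i₁ i₂ ─ a ⟶ i₁'
    parˡ    : ∀ {a i₁ i₁' i₂} → i₁ ─ a ⟶ i₁' → par i₁ i₂ ─ a ⟶ par i₁' i₂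
    seqˡ    : ∀ {a i₁ i₁' i₂} → i₁ ─ a ⟶ i₁' → seq i₁ i₂ ─ a ⟶ seq i₁' i₂
    loopS-ex : ∀ {a i₁ i₁'} → i₁ ─ a ⟶ i₁' → loopS i₁ ─ a ⟶ seq i₁' (loopS i₁)
    loopP-ex : ∀ {a i₁ i₁'} → i₁ ─ a ⟶ i₁' → loopP i₁ ─ a ⟶ par i₁' (loopP i₁)
    altʳ    : ∀ {a i₁ i₂ i₂'} → i₂ ─ a ⟶ i₂' → alt i₁ i₂ ─ a ⟶ i₂'
    parʳ    : ∀ {a i₁ i₂ i₂'} → i₂ ─ a ⟶ i₂' → par i₁ i₂ ─ a ⟶ par i₁ i₂'
    seqʳ    : ∀ {a i₁ i₂ i₂'} → i₂ ─ a ⟶ i₂' → i₁ ↓ → seq i₁ i₂ ─ a ⟶ i₂'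

  data σo {L} : Interaction L → MSet L where
    σo-term : ∀ {i} → i ↓ → σo i (ε L)
    σo-step : ∀ {i i' a μ} → σo i' μ → i ─ a ⟶ i' → σo i (a ^ μ)

{-# OPTIONS --safe #-}
module Submission where

-- A terminating interaction denotes ε_L, and every execution step i ─a⟶ i' gives
-- a ^ σ(i') ⊆ σ(i): prefixing an action commutes with ; and || in the operand that
-- moved, and the unfolding of loop_S / loop_P is one more iteration of the star.

open import Defs
open import Data.List using (List; []; _∷_)
open import Data.List.Relation.Unary.Unique.Propositional using (Unique)
open import Data.List.Relation.Unary.All using ([]; _∷_)
open import Data.List.Membership.Propositional using (_∈_)
open import Data.List.Relation.Unary.Any using (here; there)
open import Data.Product using (_,_)
open import Data.Sum using (inj₁; inj₂)
open import Data.Nat using (suc)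
open import Data.Unit using (tt)
open import Relation.Binary.PropositionalEquality using (_≡_; refl; sym; cong)

module _ {Lf M : Set} where

  ⨟-identityˡ : ∀ {L} (μ : MTrace {Lf} {M} L) → (ε L ⨟ μ) ≡ μ
  ⨟-identityˡ []      = refl
  ⨟-identityˡ (t ∷ μ) = cong (t ∷_) (⨟-identityˡ μ)

  MShuffle-ε : (L : List Lf) → MShuffle {Lf} {M} (ε L) (ε L) (ε L)
  MShuffle-ε []      = tt
  MShuffle-ε (_ ∷ L) = sh[] , MShuffle-ε L

  prependAt-⨟ : ∀ {L l} (p : l ∈ L) (x : ActOn {Lf} {M} l) (μ₁ μ₂ : MTrace L) →
    prependAt p x (μ₁ ⨟ μ₂) ≡ (prependAt p x μ₁ ⨟ μ₂)
  prependAt-⨟ (here refl) _ (_ ∷ _)  (_ ∷ _)  = refl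
  prependAt-⨟ (there p)   x (_ ∷ μ₁) (_ ∷ μ₂) = cong (_ ∷_) (prependAt-⨟ p x μ₁ μ₂)

  MShuffle-prependAtˡ : ∀ {L l} (p : l ∈ L) (x : ActOn {Lf} {M} l) {μ₁ μ₂ μ : MTrace L} →
    MShuffle μ₁ μ₂ μ → MShuffle (prependAt p x μ₁) μ₂ (prependAt p x μ)
  MShuffle-prependAtˡ (here refl) _ {_ ∷ _} {_ ∷ _} {_ ∷ _} (s , r) = shˡ s , r
  MShuffle-prependAtˡ (there p)   x {_ ∷ _} {_ ∷ _} {_ ∷ _} (s , r) = s , MShuffle-prependAtˡ p x r

  MShuffle-prependAtʳ : ∀ {L l} (p : l ∈ L) (x : ActOn {Lf} {M} l) {μ₁ μ₂ μ : MTrace L} →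
    MShuffle μ₁ μ₂ μ → MShuffle μ₁ (prependAt p x μ₂) (prependAt p x μ)
  MShuffle-prependAtʳ (here refl) _ {_ ∷ _} {_ ∷ _} {_ ∷ _} (s , r) = shʳ s , r
  MShuffle-prependAtʳ (there p)   x {_ ∷ _} {_ ∷ _} {_ ∷ _} (s , r) = s , MShuffle-prependAtʳ p x r

module _ {Lf M : Set} {L : List Lf} where

  ^-⨟ : (a : Action {Lf} {M} L) (μ₁ μ₂ : MTrace L) → (a ^ (μ₁ ⨟ μ₂)) ≡ ((a ^ μ₁) ⨟ μ₂)
  ^-⨟ (mkAction _ p x) = prependAt-⨟ p x

  MShuffle-^ˡ : (a : Action {Lf} {M} L) {μ₁ μ₂ μ : MTrace L} →
    MShuffle μ₁ μ₂ μ → MShuffle (a ^ μ₁) μ₂ (a ^ μ)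
  MShuffle-^ˡ (mkAction _ p x) = MShuffle-prependAtˡ p x

  MShuffle-^ʳ : (a : Action {Lf} {M} L) {μ₁ μ₂ μ : MTrace L} →
    MShuffle μ₁ μ₂ μ → MShuffle μ₁ (a ^ μ₂) (a ^ μ)
  MShuffle-^ʳ (mkAction _ p x) = MShuffle-prependAtʳ p x

  ↓⇒σ-ε : {i : Interaction {Lf} {M} L} → i ↓ → σ i (ε L)
  ↓⇒σ-ε ∅↓          = refl
  ↓⇒σ-ε loopS↓      = 0 , refl
  ↓⇒σ-ε loopP↓      = 0 , refl
  ↓⇒σ-ε (altˡ↓ d)   = inj₁ (↓⇒σ-ε d)
  ↓⇒σ-ε (altʳ↓ d)   = inj₂ (↓⇒σ-ε d)
  ↓⇒σ-ε (seq↓ d e)  = ε L , ε L , ↓⇒σ-ε d , ↓⇒σ-ε e , sym (⨟-identityˡ (ε L))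
  ↓⇒σ-ε (par↓ d e)  = ε L , ε L , ↓⇒σ-ε d , ↓⇒σ-ε e , MShuffle-ε L

  ⟶⇒σ-^ : {i i' : Interaction {Lf} {M} L} {a : Action L} →
    i ─ a ⟶ i' → ∀ {μ} → σ i' μ → σ i (a ^ μ)
  ⟶⇒σ-^ act-ex refl = refl
  ⟶⇒σ-^ (altˡ s) h = inj₁ (⟶⇒σ-^ s h)
  ⟶⇒σ-^ (altʳ s) h = inj₂ (⟶⇒σ-^ s h)
  ⟶⇒σ-^ {a = a} (seqˡ s) (μ₁ , μ₂ , h₁ , h₂ , refl) =
    a ^ μ₁ , μ₂ , ⟶⇒σ-^ s h₁ , h₂ , ^-⨟ a μ₁ μ₂
  ⟶⇒σ-^ {a = a} (seqʳ s d) {μ} h =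
    ε L , a ^ μ , ↓⇒σ-ε d , ⟶⇒σ-^ s h , sym (⨟-identityˡ (a ^ μ))
  ⟶⇒σ-^ {a = a} (parˡ s) (μ₁ , μ₂ , h₁ , h₂ , r) =
    a ^ μ₁ , μ₂ , ⟶⇒σ-^ s h₁ , h₂ , MShuffle-^ˡ a r
  ⟶⇒σ-^ {a = a} (parʳ s) (μ₁ , μ₂ , h₁ , h₂ , r) =
    μ₁ , a ^ μ₂ , h₁ , ⟶⇒σ-^ s h₂ , MShuffle-^ʳ a r
  ⟶⇒σ-^ {a = a} (loopS-ex s) (μ₁ , μ₂ , h₁ , (j , h₂) , refl) =
    suc j , a ^ μ₁ , μ₂ , ⟶⇒σ-^ s h₁ , h₂ , ^-⨟ a μ₁ μ₂
  ⟶⇒σ-^ {a = a} (loopP-ex s) (μ₁ , μ₂ , h₁ , (j , h₂) , r) =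
    suc j , a ^ μ₁ , μ₂ , ⟶⇒σ-^ s h₁ , h₂ , MShuffle-^ˡ a r

  σo⊆σ : {i : Interaction {Lf} {M} L} {μ : MTrace L} → σo i μ → σ i μ
  σo⊆σ (σo-term d)   = ↓⇒σ-ε d
  σo⊆σ (σo-step h s) = ⟶⇒σ-^ s (σo⊆σ h)

theorem3 : {Lf M : Set} (L : List Lf) → Unique L →
    (i : Interaction {Lf} {M} L) → ∀ μ → σo i μ → σ i μ
theorem3 L _ i μ = σo⊆σ
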